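{- Let $\mathcal{A}\subseteq\binom{[n]}{r}$ be a compressed family. Then $\mathcal{A}$ is intersecting if and only if for any $A=\{a_1,\dots,a_r\},B=\{b_1,\dots,b_r\}\in\mathcal{A}$ (not necessarily distinct) there exist $i,j$ with $1\le i,j\le r$ such that $i+j>\max\{a_i,b_j\}$.
   Context: $[n]=\{1,\dots,n\}$; $\binom{[n]}{r}$ is the set of $r$-subsets of $[n]$, with elements listed increasingly ($a_1<\dots<a_r$). A family $\mathcal{A}\subseteq\binom{[n]}{r}$ is intersecting if $B\cap C\ne\emptyset$ for all $B,C\in\mathcal{A}$. Compression order: $A\le B$ iff $a_i\le b_i$ for all $i$; $\mathcal{A}$ is compressed if $A\in\mathcal{A}$ and $B\le A$ imply $B\in\mathcal{A}$. -}

module Defs where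

open import Data.Nat using (ℕ; suc; _+_; _≤_; _<_; _⊔_)
open import Data.Fin using (Fin; toℕ)
open import Data.Vec using (Vec; lookup)
open import Data.Product using (Σ; _×_; ∃; ∃-syntax)
open import Relation.Binary.PropositionalEquality using (_≡_)

-- An r-subset of [n] = {1,…,n}, listed increasingly a₁ < … < a_r,
-- is represented by the vector (a₁, …, a_r).  Index i : Fin r stands for
-- the paper's index toℕ i + 1.
IsRSubset : (n r : ℕ) → Vec ℕ r → Set
IsRSubset n r A =
  (∀ (i : Fin r) → 1 ≤ lookup A i × lookup A i ≤ n)
  × (∀ (i j : Fin r) → toℕ i < toℕ j → lookup A i < lookup A j)

IsFamily : (n r : ℕ) → (Vec ℕ r → Set) → Set
IsFamily n r 𝒜 = ∀ A → 𝒜 A → IsRSubset n r A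

_∈ₛ_ : {r : ℕ} → ℕ → Vec ℕ r → Set
_∈ₛ_ {r} x A = ∃[ i ] lookup A i ≡ x

Intersecting : {r : ℕ} → (Vec ℕ r → Set) → Set
Intersecting 𝒜 = ∀ B C → 𝒜 B → 𝒜 C → ∃[ x ] (x ∈ₛ B × x ∈ₛ C)

_≤ᶜ_ : {r : ℕ} → Vec ℕ r → Vec ℕ r → Set
_≤ᶜ_ {r} A B = ∀ (i : Fin r) → lookup A i ≤ lookup B i

Compressed : (n r : ℕ) → (Vec ℕ r → Set) → Set
Compressed n r 𝒜 = ∀ A B → 𝒜 A → IsRSubset n r B → B ≤ᶜ A → 𝒜 B

-- the condition of the proposition, with 1-based indices i+1, j+1:
-- (i+1) + (j+1) > max{a_{i+1}, b_{j+1}}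
IndexCondition : {r : ℕ} → (Vec ℕ r → Set) → Set
IndexCondition {r} 𝒜 = ∀ A B → 𝒜 A → 𝒜 B →
  ∃[ i ] ∃[ j ] (lookup A i ⊔ lookup B j < suc (toℕ i) + suc (toℕ j))

-- If i + j > max{a_i, b_j}, then a_1 < … < a_i and b_1 < … < b_j all lie in
-- [i + j - 1], so A and B meet by pigeonhole.  Conversely, if A, B ∈ 𝒜 violate
-- the condition, merge them into one sorted list (ties putting a before b) and
-- let A', B' be the sets of positions taken by the a's and the b's.  A' and B'
-- are disjoint r-sets, and a_i ≥ i + j whenever b_j < a_i says exactly that the
-- position of a_i does not exceed a_i, so A' ≤ A, likewise B' ≤ B; by
-- compression A', B' ∈ 𝒜, contradicting intersection.
module Submission where

open import Defs
open import Data.Nat using (ℕ; zero; suc; _+_; _≤_; _<_; _⊔_; z≤n; s≤s; s≤s⁻¹; _≤?_; _<?_)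
open import Data.Nat.Properties
open import Data.Empty using (⊥-elim)
open import Data.Sum using (inj₁; inj₂)
open import Data.Fin using (Fin; toℕ; fromℕ<) renaming (zero to fzero; suc to fsuc)
open import Data.Fin.Properties using (toℕ-fromℕ<; toℕ<n; any?)
open import Data.Vec using (Vec; lookup; tabulate; []; _∷_)
open import Data.Vec.Properties using (lookup∘tabulate)
open import Data.Product using (_×_; _,_; proj₁; proj₂; ∃; ∃-syntax)
open import Function using (_∘_; id)
open import Relation.Binary.Definitions using (tri<; tri≈; tri>)
open import Relation.Nullary using (¬_; Dec; yes; no)
open import Relation.Nullary.Decidable using (decidable-stable)
open import Relation.Unary using (Decidable)
open import Relation.Binary.PropositionalEquality using (_≡_; _≢_; refl; sym; trans; cong; cong₂; subst; subst₂)

DownClosedOn : ℕ → (ℕ → Set) → Set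
DownClosedOn r P = ∀ {l m} → l ≤ m → m < r → P m → P l

record IsPrefixLength (r : ℕ) (P : ℕ → Set) (c : ℕ) : Set where
  field
    ≤-bound  : c ≤ r
    sound    : ∀ {l} → l < c → P l
    complete : ∀ {l} → l < r → P l → l < c

  ¬P⇒≤ : ∀ {l} → ¬ P l → c ≤ l
  ¬P⇒≤ ¬Pl = ≮⇒≥ (¬Pl ∘ sound)

longestPrefix : {P : ℕ → Set} → Decidable P → ∀ r →
  ∃[ c ] (c ≤ r × (∀ {l} → l < c → P l) × (c < r → ¬ P c))
longestPrefix P? zero = 0 , z≤n , (λ ()) , λ ()
longestPrefix {P} P? (suc r) with longestPrefix P? r
... | c , c≤r , sound , stop with m≤n⇒m<n∨m≡n c≤r
...   | inj₁ c<r = c , m≤n⇒m≤1+n c≤r , sound , λ _ → stop c<r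
...   | inj₂ refl with P? c
...     | no ¬Pc = c , n≤1+n c , sound , λ _ → ¬Pc
...     | yes Pc = suc c , ≤-refl , sound′ , λ c<c → ⊥-elim (<-irrefl refl (s≤s⁻¹ c<c))
  where
  sound′ : ∀ {l} → l < suc c → P l
  sound′ l<1+c with m≤n⇒m<n∨m≡n (s≤s⁻¹ l<1+c)
  ... | inj₁ l<c = sound l<c
  ... | inj₂ refl = Pc

prefixLength : {P : ℕ → Set} → Decidable P → ∀ {r} → DownClosedOn r P → ∃ (IsPrefixLength r P)
prefixLength {P} P? {r} closed with longestPrefix P? r
... | c , c≤r , sound , stop = c , record { ≤-bound = c≤r ; sound = sound ; complete = complete }
  where
  complete : ∀ {l} → l < r → P l → l < c
  complete l<r Pl = ≰⇒> λ c≤l → stop (≤-<-trans c≤l l<r) (closed c≤l l<r Pl)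

prefixLength-mono : ∀ {r} {P Q : ℕ → Set} {c d} →
  IsPrefixLength r P c → IsPrefixLength r Q d →
  (∀ {l} → P l → Q l) → c ≤ d
prefixLength-mono pc qd P⇒Q = ≮⇒≥ λ d<c →
  <-irrefl refl (IsPrefixLength.complete qd (<-≤-trans d<c (IsPrefixLength.≤-bound pc))
                                          (P⇒Q (IsPrefixLength.sound pc d<c)))

StrictlyIncreasingOn : ℕ → (ℕ → ℕ) → Set
StrictlyIncreasingOn r a = ∀ {k k′} → k < k′ → k′ < r → a k < a k′

PositiveOn : ℕ → (ℕ → ℕ) → Set
PositiveOn r a = ∀ {k} → k < r → 1 ≤ a k

module _ {r : ℕ} {a : ℕ → ℕ} (a-inc : StrictlyIncreasingOn r a) where

  increasing⇒monotone : ∀ {k k′} → k ≤ k′ → k′ < r → a k ≤ a k′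
  increasing⇒monotone k≤k′ k′<r with m≤n⇒m<n∨m≡n k≤k′
  ... | inj₁ k<k′ = <⇒≤ (a-inc k<k′ k′<r)
  ... | inj₂ refl = ≤-refl

  index<value : PositiveOn r a → ∀ {k} → k < r → k < a k
  index<value a-pos {zero} 0<r = a-pos 0<r
  index<value a-pos {suc k} k+1<r =
    ≤-<-trans (index<value a-pos (<-trans (n<1+n k) k+1<r)) (a-inc (n<1+n k) k+1<r)

-- With 0-based indices, a i , b j ≤ i + j + 1 means both initial segments
-- (i + 1 and j + 1 values) fit in [i + j + 1]; descending along the smaller
-- of a i, b j keeps that bound until the two values coincide.
commonValue : ∀ {r a b} → StrictlyIncreasingOn r a → PositiveOn r a →
  StrictlyIncreasingOn r b → PositiveOn r b →
  ∀ i j → i < r → j < r → a i ≤ suc (i + j) → b j ≤ suc (i + j) →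
  ∃[ k ] ∃[ l ] (k < r × l < r × a k ≡ b l)
commonValue {r} {a} {b} a-inc a-pos b-inc b-pos i j i<r j<r ai≤ bj≤ with <-cmp (a i) (b j)
... | tri≈ _ ai≡bj _ = i , j , i<r , j<r , ai≡bj
commonValue {b = b} a-inc a-pos b-inc b-pos i zero i<r j<r ai≤ bj≤ | tri< ai<bj _ _ =
  ⊥-elim (<-irrefl refl (≤-trans (≤-<-trans (index<value a-inc a-pos i<r) ai<bj)
                                  (subst (λ m → b zero ≤ suc m) (+-identityʳ i) bj≤)))
commonValue {r} {a} {b} a-inc a-pos b-inc b-pos i (suc j) i<r j+1<r ai≤ bj+1≤ | tri< ai<bj _ _ =
  commonValue a-inc a-pos b-inc b-pos i j i<r (<-trans (n<1+n j) j+1<r)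
    (s≤s⁻¹ (<-≤-trans ai<bj bj+1≤′)) (s≤s⁻¹ (<-≤-trans (b-inc (n<1+n j) j+1<r) bj+1≤′))
  where
  bj+1≤′ : b (suc j) ≤ suc (suc (i + j))
  bj+1≤′ = subst (λ m → b (suc j) ≤ suc m) (+-suc i j) bj+1≤
commonValue a-inc a-pos b-inc b-pos zero j i<r j<r ai≤ bj≤ | tri> _ _ bj<ai =
  ⊥-elim (<-irrefl refl (≤-trans (≤-<-trans (index<value b-inc b-pos j<r) bj<ai) ai≤))
commonValue a-inc a-pos b-inc b-pos (suc i) j i+1<r j<r ai+1≤ bj≤ | tri> _ _ bj<ai =
  commonValue a-inc a-pos b-inc b-pos i j (<-trans (n<1+n i) i+1<r) j<r
    (s≤s⁻¹ (<-≤-trans (a-inc (n<1+n i) i+1<r) ai+1≤)) (s≤s⁻¹ (<-≤-trans bj<ai ai+1≤))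

merge-gap : ∀ {x y k l : ℕ} → x ≤ l → suc k ≤ y → suc k + x < suc l + y
merge-gap {x} {y} {k} {l} x≤l k<y = begin-strict
  suc k + x     ≤⟨ +-monoʳ-≤ (suc k) x≤l ⟩
  suc k + l     ≡⟨ +-comm (suc k) l ⟩
  l + suc k     <⟨ n<1+n (l + suc k) ⟩
  suc l + suc k ≤⟨ +-monoʳ-≤ (suc l) k<y ⟩
  suc l + y     ∎
  where open ≤-Reasoning

-- In the merge, u k is preceded by k of the u's and by the c of the v's satisfying Q.
position≤value : ∀ {r} {u v : ℕ → ℕ} {Q : ℕ → Set} {c k} →
  StrictlyIncreasingOn r u → PositiveOn r u →
  (∀ {k l} → k < r → l < r → suc k + suc l ≤ u k ⊔ v l) →
  IsPrefixLength r Q c → (∀ {l} → Q l → v l ≤ u k) → k < r → suc k + c ≤ u k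
position≤value {u = u} {c = zero} {k} u-inc u-pos spread _ _ k<r =
  subst (_≤ u k) (sym (+-identityʳ (suc k))) (index<value u-inc u-pos k<r)
position≤value {c = suc l} {k} u-inc u-pos spread pc Q⇒≤ k<r =
  subst (suc k + suc l ≤_) (m≥n⇒m⊔n≡m (Q⇒≤ (sound ≤-refl)))
        (spread k<r (<-≤-trans (n<1+n l) ≤-bound))
  where open IsPrefixLength pc

module Merge {r : ℕ} {a b : ℕ → ℕ}
  (a-inc : StrictlyIncreasingOn r a) (b-inc : StrictlyIncreasingOn r b) where

  rankB-prefixLength : ∀ x → ∃ (IsPrefixLength r (λ l → b l < x))
  rankB-prefixLength x = prefixLength (λ l → b l <? x)
    (λ l≤m m<r bm<x → ≤-<-trans (increasing⇒monotone b-inc l≤m m<r) bm<x)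

  rankA-prefixLength : ∀ x → ∃ (IsPrefixLength r (λ k → a k ≤ x))
  rankA-prefixLength x = prefixLength (λ k → a k ≤? x)
    (λ k≤m m<r am≤x → ≤-trans (increasing⇒monotone a-inc k≤m m<r) am≤x)

  rankB rankA : ℕ → ℕ
  rankB = proj₁ ∘ rankB-prefixLength
  rankA = proj₁ ∘ rankA-prefixLength

  rankB-isPrefixLength : ∀ x → IsPrefixLength r (λ l → b l < x) (rankB x)
  rankB-isPrefixLength = proj₂ ∘ rankB-prefixLength

  rankA-isPrefixLength : ∀ x → IsPrefixLength r (λ k → a k ≤ x) (rankA x)
  rankA-isPrefixLength = proj₂ ∘ rankA-prefixLength

  -- 1-based positions in the merged sorted list; on ties a k comes before b l.
  positionA positionB : ℕ → ℕ
  positionA k = suc k + rankB (a k)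
  positionB l = suc l + rankA (b l)

  positionA-increasing : StrictlyIncreasingOn r positionA
  positionA-increasing k<k′ k′<r =
    +-mono-<-≤ (s≤s k<k′) (prefixLength-mono (rankB-isPrefixLength _) (rankB-isPrefixLength _)
                             (λ bl<ak → <-trans bl<ak (a-inc k<k′ k′<r)))

  positionB-increasing : StrictlyIncreasingOn r positionB
  positionB-increasing l<l′ l′<r =
    +-mono-<-≤ (s≤s l<l′) (prefixLength-mono (rankA-isPrefixLength _) (rankA-isPrefixLength _)
                             (λ ak≤bl → ≤-trans ak≤bl (<⇒≤ (b-inc l<l′ l′<r))))

  positionA≢positionB : ∀ {k l} → k < r → l < r → positionA k ≢ positionB l
  positionA≢positionB {k} {l} k<r l<r eq with ≤-<-connex (a k) (b l)
  ... | inj₁ ak≤bl = <-irrefl eq (merge-gap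
          (IsPrefixLength.¬P⇒≤ (rankB-isPrefixLength (a k)) (≤⇒≯ ak≤bl))
          (IsPrefixLength.complete (rankA-isPrefixLength (b l)) k<r ak≤bl))
  ... | inj₂ bl<ak = <-irrefl (sym eq) (merge-gap
          (IsPrefixLength.¬P⇒≤ (rankA-isPrefixLength (b l)) (<⇒≱ bl<ak))
          (IsPrefixLength.complete (rankB-isPrefixLength (a k)) l<r bl<ak))

  module Bounds (a-pos : PositiveOn r a) (b-pos : PositiveOn r b)
    (spread : ∀ {k l} → k < r → l < r → suc k + suc l ≤ a k ⊔ b l) where

    positionA≤a : ∀ {k} → k < r → positionA k ≤ a k
    positionA≤a = position≤value a-inc a-pos spread (rankB-isPrefixLength _) <⇒≤

    positionB≤b : ∀ {l} → l < r → positionB l ≤ b l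
    positionB≤b = position≤value b-inc b-pos spread′ (rankA-isPrefixLength _) id
      where
      spread′ : ∀ {l k} → l < r → k < r → suc l + suc k ≤ b l ⊔ a k
      spread′ {l} {k} l<r k<r =
        subst₂ _≤_ (+-comm (suc k) (suc l)) (⊔-comm (a k) (b l)) (spread k<r l<r)

-- Reading past the end of the vector returns the junk value 0.
at : ∀ {r} → Vec ℕ r → ℕ → ℕ
at []       _       = 0
at (x ∷ _)  zero    = x
at (_ ∷ xs) (suc k) = at xs k

lookup≡at : ∀ {r} (A : Vec ℕ r) (i : Fin r) → lookup A i ≡ at A (toℕ i)
lookup≡at (x ∷ A) fzero    = refl
lookup≡at (x ∷ A) (fsuc i) = lookup≡at A i

lookup-fromℕ<≡at : ∀ {r} (A : Vec ℕ r) {k} (k<r : k < r) → lookup A (fromℕ< k<r) ≡ at A k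
lookup-fromℕ<≡at (x ∷ A) {zero}  _         = refl
lookup-fromℕ<≡at (x ∷ A) {suc k} (s≤s k<r) = lookup-fromℕ<≡at A k<r

module _ {n r : ℕ} (A : Vec ℕ r) (A-sub : IsRSubset n r A) where

  at-increasing : StrictlyIncreasingOn r (at A)
  at-increasing {k} {k′} k<k′ k′<r =
    subst₂ _<_ (lookup-fromℕ<≡at A k<r) (lookup-fromℕ<≡at A k′<r)
      (proj₂ A-sub (fromℕ< k<r) (fromℕ< k′<r)
        (subst₂ _<_ (sym (toℕ-fromℕ< k<r)) (sym (toℕ-fromℕ< k′<r)) k<k′))
    where k<r = <-trans k<k′ k′<r

  at-positive : PositiveOn r (at A)
  at-positive k<r = subst (1 ≤_) (lookup-fromℕ<≡at A k<r) (proj₁ (proj₁ A-sub (fromℕ< k<r)))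

  at-bounded : ∀ {k} → k < r → at A k ≤ n
  at-bounded k<r = subst (_≤ n) (lookup-fromℕ<≡at A k<r) (proj₂ (proj₁ A-sub (fromℕ< k<r)))

toVec : (r : ℕ) → (ℕ → ℕ) → Vec ℕ r
toVec r f = tabulate (f ∘ toℕ)

toVec-isRSubset : ∀ {n r f} → StrictlyIncreasingOn r f → PositiveOn r f →
  (∀ {k} → k < r → f k ≤ n) → IsRSubset n r (toVec r f)
toVec-isRSubset {n} {r} {f} f-inc f-pos f-bnd =
  (λ i → subst (1 ≤_) (sym (lookup∘tabulate _ i)) (f-pos (toℕ<n i))
       , subst (_≤ n) (sym (lookup∘tabulate _ i)) (f-bnd (toℕ<n i)))
  , λ i j i<j → subst₂ _<_ (sym (lookup∘tabulate _ i)) (sym (lookup∘tabulate _ j))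
                       (f-inc i<j (toℕ<n j))

Meet : ∀ {r} → Vec ℕ r → Vec ℕ r → Set
Meet A B = ∃[ x ] (x ∈ₛ A × x ∈ₛ B)

IndexPair : ∀ {r} → Vec ℕ r → Vec ℕ r → Set
IndexPair A B = ∃[ i ] ∃[ j ] (lookup A i ⊔ lookup B j < suc (toℕ i) + suc (toℕ j))

indexPair? : ∀ {r} (A B : Vec ℕ r) → Dec (IndexPair A B)
indexPair? A B = any? λ i → any? λ j → lookup A i ⊔ lookup B j <? suc (toℕ i) + suc (toℕ j)

indexPair⇒meet : ∀ {n r} (A B : Vec ℕ r) → IsRSubset n r A → IsRSubset n r B →
  IndexPair A B → Meet A B
indexPair⇒meet A B A-sub B-sub (i , j , max<)
  with commonValue (at-increasing A A-sub) (at-positive A A-sub)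
                   (at-increasing B B-sub) (at-positive B B-sub)
         (toℕ i) (toℕ j) (toℕ<n i) (toℕ<n j)
         (subst (_≤ _) (lookup≡at A i) (≤-bound (≤-<-trans (m≤m⊔n _ _) max<)))
         (subst (_≤ _) (lookup≡at B j) (≤-bound (≤-<-trans (m≤n⊔m _ _) max<)))
  where
  ≤-bound : ∀ {x} → x < suc (toℕ i) + suc (toℕ j) → x ≤ suc (toℕ i + toℕ j)
  ≤-bound {x} x< = s≤s⁻¹ (subst (x <_) (cong suc (+-suc (toℕ i) (toℕ j))) x<)
... | k , l , k<r , l<r , ak≡bl =
  at A k , (fromℕ< k<r , lookup-fromℕ<≡at A k<r)
         , (fromℕ< l<r , trans (lookup-fromℕ<≡at B l<r) (sym ak≡bl))

¬indexPair⇒disjointBelow : ∀ {n r} (A B : Vec ℕ r) → IsRSubset n r A → IsRSubset n r B →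
  ¬ IndexPair A B →
  ∃[ A′ ] ∃[ B′ ] (IsRSubset n r A′ × IsRSubset n r B′ × A′ ≤ᶜ A × B′ ≤ᶜ B × ¬ Meet A′ B′)
¬indexPair⇒disjointBelow {n} {r} A B A-sub B-sub ¬index =
  toVec r positionA , toVec r positionB
  , toVec-isRSubset positionA-increasing (λ _ → s≤s z≤n)
      (λ k<r → ≤-trans (positionA≤a k<r) (at-bounded A A-sub k<r))
  , toVec-isRSubset positionB-increasing (λ _ → s≤s z≤n)
      (λ l<r → ≤-trans (positionB≤b l<r) (at-bounded B B-sub l<r))
  , (λ i → subst₂ _≤_ (sym (lookup∘tabulate _ i)) (sym (lookup≡at A i)) (positionA≤a (toℕ<n i)))
  , (λ j → subst₂ _≤_ (sym (lookup∘tabulate _ j)) (sym (lookup≡at B j)) (positionB≤b (toℕ<n j)))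
  , λ { (x , (i , A′i≡x) , (j , B′j≡x)) → positionA≢positionB (toℕ<n i) (toℕ<n j)
          (trans (sym (lookup∘tabulate _ i))
                 (trans A′i≡x (trans (sym B′j≡x) (lookup∘tabulate _ j)))) }
  where
  spread : ∀ {k l} → k < r → l < r → suc k + suc l ≤ at A k ⊔ at B l
  spread {k} {l} k<r l<r = ≮⇒≥ λ max< → ¬index (fromℕ< k<r , fromℕ< l<r ,
    subst₂ _<_ (sym (cong₂ _⊔_ (lookup-fromℕ<≡at A k<r) (lookup-fromℕ<≡at B l<r)))
               (sym (cong₂ (λ x y → suc x + suc y) (toℕ-fromℕ< k<r) (toℕ-fromℕ< l<r))) max<)
  open Merge (at-increasing A A-sub) (at-increasing B B-sub)
  open Bounds (at-positive A A-sub) (at-positive B B-sub) spread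

proposition7 : (n r : ℕ) (𝒜 : Vec ℕ r → Set) → IsFamily n r 𝒜 → Compressed n r 𝒜 →
    (Intersecting 𝒜 → IndexCondition 𝒜) × (IndexCondition 𝒜 → Intersecting 𝒜)
proposition7 n r 𝒜 family compressed = intersecting⇒index , index⇒intersecting
  where
  index⇒intersecting : IndexCondition 𝒜 → Intersecting 𝒜
  index⇒intersecting index A B A∈𝒜 B∈𝒜 =
    indexPair⇒meet A B (family A A∈𝒜) (family B B∈𝒜) (index A B A∈𝒜 B∈𝒜)

  intersecting⇒index : Intersecting 𝒜 → IndexCondition 𝒜
  intersecting⇒index intersecting A B A∈𝒜 B∈𝒜 = decidable-stable (indexPair? A B) λ ¬index →
    let A′ , B′ , A′-sub , B′-sub , A′≤A , B′≤B , disjoint =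
          ¬indexPair⇒disjointBelow A B (family A A∈𝒜) (family B B∈𝒜) ¬index
    in disjoint (intersecting A′ B′ (compressed A A′ A∈𝒜 A′-sub A′≤A)
                                    (compressed B B′ B∈𝒜 B′-sub B′≤B))
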